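{- Let $r\ge1$, $a_1,\dots,a_r\in\mathbb{N}$ and $f(x)=(x+a_1)\cdots(x+a_r)$. Let $\lambda=(\lambda_1,\dots,\lambda_t)$ be an integer partition, $n=|\lambda|$, and $k\ge t$ an integer. Then $m_\lambda(f(1),\dots,f(k))$ equals the number of $(r+1)$-tuples $(s_0,s_1,\dots,s_r)$ of integer sequences of length $n$ such that $s_0\in S_{\lambda,k}$ and $s_0\le s_i\le k+a_i$ for all $i=1,\dots,r$.
   Context: $m_\lambda(x_1,\dots,x_k)$ is the monomial symmetric polynomial: the sum of all distinct monomials $x_{\sigma(1)}^{\lambda_1}\cdots x_{\sigma(k)}^{\lambda_k}$, $\sigma\in S_k$, with $\lambda_i=0$ for $i>t$. $S_{\lambda,k}$ is the set of weakly increasing $n$-tuples of elements of $\{1,\dots,k\}$ such that the multiset of multiplicities $\{m(1),\dots,m(k)\}$ (where $m(i)$ is the number of occurrences of $i$) equals the multiset $\{\lambda_1,\dots,\lambda_k\}$. For sequences $u=(u_1,\dots,u_n)$, $v=(v_1,\dots,v_n)$ and an integer $M$, $u\le v$ means $u_p\le v_p$ for all $p$, and $u\le M$ means $u_p\le M$ for all $p$. The sequences $s_1,\dots,s_r$ need not be ordered. -}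

module Defs where

open import Data.Nat using (ℕ; zero; suc; _+_; _^_; _≤_; _≥_; _≤?_; _∸_)
open import Data.Nat.Properties using (_≟_)
open import Data.Fin using (Fin; toℕ)
open import Data.Product using (_×_; _,_; proj₁; proj₂)
open import Data.Nat.ListAction using (sum; product)
open import Data.List as L using (List; []; _∷_; length; filter; upTo; applyUpTo; replicate; _++_; cartesianProductWith; cartesianProduct)
open import Data.List.Relation.Unary.All as LAll using () renaming (All to LAll)
open import Data.List.Relation.Unary.Linked using (Linked; linked?)
open import Data.Vec as V using (Vec; []; _∷_; toList; zipWith; zip; tabulate)
open import Data.Vec.Relation.Unary.All as VAll using () renaming (All to VAll)
open import Data.Vec.Relation.Binary.Pointwise.Inductive as PW using (Pointwise)
open import Relation.Binary.PropositionalEquality using (_≡_)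
open import Relation.Nullary using (Dec; _×-dec_)

boundedVecs : (len B : ℕ) → List (Vec ℕ len)
boundedVecs zero    B = [] ∷ []
boundedVecs (suc len) B = cartesianProductWith _∷_ (upTo (suc B)) (boundedVecs len B)

mult : ℕ → List ℕ → ℕ
mult v xs = length (filter (λ x → v ≟ x) xs)

-- Multiset equality: every value has the same multiplicity in both lists.
-- (Values not occurring in xs ++ ys have multiplicity 0 in both, so it
-- suffices to quantify over the values occurring in xs ++ ys.)
SameMultiset : List ℕ → List ℕ → Set
SameMultiset xs ys = LAll (λ v → mult v xs ≡ mult v ys) (xs ++ ys)

sameMultiset? : (xs ys : List ℕ) → Dec (SameMultiset xs ys)
sameMultiset? xs ys = LAll.all? (λ v → mult v xs ≟ mult v ys) (xs ++ ys)

IsPartition : List ℕ → Set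
IsPartition μ = LAll (λ x → 1 ≤ x) μ × Linked _≥_ μ

-- (λ₁,…,λₖ) with λᵢ = 0 for i > t  (used when t ≤ k)
padded : List ℕ → ℕ → List ℕ
padded μ k = μ ++ replicate (k ∸ length μ) 0

-- Every such e has entries ≤ |λ|, so
-- enumerating {0,…,|λ|}^k covers all of them (each exactly once).

monomial : List ℕ → (k : ℕ) → Vec ℕ k → ℕ
monomial μ k x =
  sum (L.map (λ e → product (toList (zipWith _^_ x e)))
             (filter (λ e → sameMultiset? (toList e) (padded μ k))
                     (boundedVecs k (sum μ))))

fpoly : {r : ℕ} → Vec ℕ r → ℕ → ℕ
fpoly a x = product (toList (V.map (x +_) a))

fvals : {r : ℕ} → Vec ℕ r → (k : ℕ) → Vec ℕ k
fvals a k = tabulate (λ (i : Fin k) → fpoly a (suc (toℕ i)))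

InS : (μ : List ℕ) (k : ℕ) → Vec ℕ (sum μ) → Set
InS μ k s =
  LAll (λ x → 1 ≤ x × x ≤ k) (toList s)
  × Linked _≤_ (toList s)
  × SameMultiset (applyUpTo (λ i → mult (suc i) (toList s)) k) (padded μ k)

InS? : (μ : List ℕ) (k : ℕ) (s : Vec ℕ (sum μ)) → Dec (InS μ k s)
InS? μ k s =
  LAll.all? (λ x → (1 ≤? x) ×-dec (x ≤? k)) (toList s)
  ×-dec linked? _≤?_ (toList s)
  ×-dec sameMultiset? (applyUpTo (λ i → mult (suc i) (toList s)) k) (padded μ k)

ValidTuple : (μ : List ℕ) (k : ℕ) {r : ℕ} (a : Vec ℕ r)
           → Vec ℕ (sum μ) × Vec (Vec ℕ (sum μ)) r → Set
ValidTuple μ k a (s₀ , ss) =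
  InS μ k s₀ ×
  VAll (λ p → Pointwise _≤_ s₀ (proj₂ p) × VAll (λ y → y ≤ k + proj₁ p) (proj₂ p))
       (zip a ss)

ValidTuple? : (μ : List ℕ) (k : ℕ) {r : ℕ} (a : Vec ℕ r)
            → (t : Vec ℕ (sum μ) × Vec (Vec ℕ (sum μ)) r) → Dec (ValidTuple μ k a t)
ValidTuple? μ k a (s₀ , ss) =
  InS? μ k s₀ ×-dec
  VAll.all? (λ p → PW.decidable _≤?_ s₀ (proj₂ p)
                   ×-dec VAll.all? (λ y → y ≤? k + proj₁ p) (proj₂ p))
            (zip a ss)

candidateSeqs : (n k : ℕ) {r : ℕ} → Vec ℕ r → List (Vec (Vec ℕ n) r)
candidateSeqs n k []       = [] ∷ []
candidateSeqs n k (ai ∷ a) =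
  cartesianProductWith _∷_ (boundedVecs n (k + ai)) (candidateSeqs n k a)

-- Number of valid (r+1)-tuples.  Any valid tuple has s₀ ∈ {0..k}^n and
-- sᵢ ∈ {0..k+aᵢ}^n, so the (duplicate-free) enumeration below covers all.
countTuples : (μ : List ℕ) (k : ℕ) {r : ℕ} → Vec ℕ r → ℕ
countTuples μ k a =
  length (filter (ValidTuple? μ k a)
                 (cartesianProduct (boundedVecs (sum μ) k) (candidateSeqs (sum μ) k a)))

-- For fixed s₀ the sequences sᵢ are chosen independently and coordinatewise, s₀ₚ ≤ sᵢₚ ≤ k + aᵢ,
-- so s₀ contributes ∏ᵢ ∏ₚ (k + aᵢ + 1 − s₀ₚ) = ∏ₚ f(k + 1 − s₀ₚ) tuples. A weakly increasing s₀ is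
-- determined by its multiplicities m(1), …, m(k), and its contribution is ∏ᵥ f(k + 1 − v)^m(v).
-- Reading the multiplicities backwards, e = (m(k), …, m(1)), is a bijection from S_{λ,k} onto the
-- distinct rearrangements of (λ₁, …, λₖ), under which that contribution becomes the monomial
-- f(1)^e₁ ⋯ f(k)^eₖ of m_λ(f(1), …, f(k)).

module Submission where

open import Defs
open import Algebra.Properties.CommutativeSemigroup using (interchange)
open import Data.Bool using (true; false; if_then_else_)
open import Data.Empty using (⊥-elim)
open import Data.Fin as Fin using (Fin; toℕ)
open import Data.Nat using (ℕ; zero; suc; _≤_; _+_; _*_; _∸_; _<_; _^_; _≤?_; s≤s; z<s; s<s)
open import Data.Nat.Properties
open import Data.Nat.ListAction using (sum; product)
open import Data.Nat.ListAction.Properties using (sum-++; sum-↭; product-↭)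
open import Data.List
  using (List; []; _∷_; length; _++_; _∷ʳ_; map; filter; replicate; reverse; upTo; applyUpTo; applyDownFrom;
         cartesianProductWith; cartesianProduct)
open import Data.List.Properties
  using (map-∘; map-cong; map-cong-local; upTo-∷ʳ; filter-accept; filter-reject; length-filter; length-++;
         length-replicate; length-reverse; reverse-applyUpTo; reverse-involutive; reverse-injective)
open import Data.List.Membership.Propositional using (_∈_; _∉_)
open import Data.List.Membership.Propositional.Properties
  using (∈-map⁺; ∈-map⁻; ∈-filter⁺; ∈-filter⁻; ∈-∃++; ∈-++⁺ˡ; ∈-++⁺ʳ; ∈-upTo⁺; ∈-upTo⁻;
         ∈-cartesianProductWith⁺; ∈-cartesianProductWith⁻)
open import Data.List.Membership.Propositional.Properties.WithK using (unique∧set⇒bag)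
open import Data.List.Membership.DecPropositional _≟_ using (_∈?_)
open import Data.List.Relation.Unary.Any using (here; there)
open import Data.List.Relation.Unary.All as All using (All; []; _∷_)
import Data.List.Relation.Unary.All.Properties as All
open import Data.List.Relation.Unary.AllPairs using ([]; _∷_)
open import Data.List.Relation.Unary.Linked as Linked using (Linked; []; [-]; _∷_)
open import Data.List.Relation.Unary.Linked.Properties using (Linked⇒All)
open import Data.List.Relation.Unary.Unique.Propositional using (Unique)
import Data.List.Relation.Unary.Unique.Propositional.Properties as Unique
open import Data.List.Relation.Binary.BagAndSetEquality using (∼bag⇒↭)
open import Data.List.Relation.Binary.Permutation.Propositional
  using (_↭_; ↭-refl; ↭-trans; ↭-sym; ↭-prep; module PermutationReasoning)
open import Data.List.Relation.Binary.Permutation.Propositional.Properties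
  using (map⁺; ↭-length; ↭-reverse; filter-↭; shift)
open import Data.Product using (_×_; _,_; ∃; proj₁; proj₂)
open import Data.Vec as Vec using (Vec; []; _∷_; toList; zip)
open import Data.Vec.Properties
  using (toList-map; length-toList; toList-injective; cast-is-id; toList-cast; toList∘fromList)
open import Data.Vec.Relation.Unary.All as VAll using () renaming (All to VAll)
open import Data.Vec.Relation.Binary.Pointwise.Inductive as Pointwise using (Pointwise)
open import Function using (_∘_)
open import Function.Bundles using (mk⇔)
open import Relation.Nullary using (Dec; does; yes; no)
open import Relation.Nullary.Decidable using (_×-dec_; dec-true)
open import Relation.Unary using (Decidable)
open import Relation.Binary.PropositionalEquality
  using (_≡_; _≢_; ≢-sym; refl; sym; trans; cong; cong₂; subst; module ≡-Reasoning)

∑ : {A : Set} → List A → (A → ℕ) → ℕ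
∑ xs f = sum (map f xs)

𝟙 : {P : Set} → Dec P → ℕ
𝟙 p = if does p then 1 else 0

𝟙-×-dec : {P Q : Set} (p : Dec P) (q : Dec Q) → 𝟙 (p ×-dec q) ≡ 𝟙 p * 𝟙 q
𝟙-×-dec p q with does p
... | true  = sym (+-identityʳ _)
... | false = refl

length-filter≡∑𝟙 : {A : Set} {P : A → Set} (P? : Decidable P) (xs : List A)
                 → length (filter P? xs) ≡ ∑ xs (λ x → 𝟙 (P? x))
length-filter≡∑𝟙 P? [] = refl
length-filter≡∑𝟙 P? (x ∷ xs) with does (P? x)
... | true  = cong suc (length-filter≡∑𝟙 P? xs)
... | false = length-filter≡∑𝟙 P? xs

∑-filter : {A : Set} {P : A → Set} (P? : Decidable P) (xs : List A) (f : A → ℕ)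
         → ∑ (filter P? xs) f ≡ ∑ xs (λ x → 𝟙 (P? x) * f x)
∑-filter P? [] f = refl
∑-filter P? (x ∷ xs) f with does (P? x)
... | true  = cong₂ _+_ (sym (+-identityʳ (f x))) (∑-filter P? xs f)
... | false = ∑-filter P? xs f

∑-++ : {A : Set} (xs ys : List A) (f : A → ℕ) → ∑ (xs ++ ys) f ≡ ∑ xs f + ∑ ys f
∑-++ [] ys f = refl
∑-++ (x ∷ xs) ys f = trans (cong (f x +_) (∑-++ xs ys f)) (sym (+-assoc (f x) _ _))

∑-cong : {A : Set} (xs : List A) {f g : A → ℕ} → (∀ {x} → x ∈ xs → f x ≡ g x) → ∑ xs f ≡ ∑ xs g
∑-cong [] eq = refl
∑-cong (x ∷ xs) eq = cong₂ _+_ (eq (here refl)) (∑-cong xs (eq ∘ there))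

∑-*ˡ : {A : Set} (c : ℕ) (xs : List A) (f : A → ℕ) → ∑ xs (λ x → c * f x) ≡ c * ∑ xs f
∑-*ˡ c [] f = sym (*-zeroʳ c)
∑-*ˡ c (x ∷ xs) f = trans (cong (c * f x +_) (∑-*ˡ c xs f)) (sym (*-distribˡ-+ c (f x) _))

∑-cartesianProductWith : {A B C : Set} (_⊕_ : A → B → C) (xs : List A) (ys : List B) (h : C → ℕ)
  → ∑ (cartesianProductWith _⊕_ xs ys) h ≡ ∑ xs (λ x → ∑ ys (λ y → h (x ⊕ y)))
∑-cartesianProductWith _⊕_ [] ys h = refl
∑-cartesianProductWith _⊕_ (x ∷ xs) ys h =
  trans (∑-++ (map (x ⊕_) ys) _ h)
        (cong₂ _+_ (cong sum (sym (map-∘ ys))) (∑-cartesianProductWith _⊕_ xs ys h))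

∑∑-* : {A B : Set} (xs : List A) (ys : List B) (f : A → ℕ) (g : B → ℕ)
     → ∑ xs (λ x → ∑ ys (λ y → f x * g y)) ≡ ∑ xs f * ∑ ys g
∑∑-* [] ys f g = refl
∑∑-* (x ∷ xs) ys f g =
  trans (cong₂ _+_ (∑-*ˡ (f x) ys g) (∑∑-* xs ys f g)) (sym (*-distribʳ-+ (∑ ys g) (f x) _))

Unique-map⁺ : {A B : Set} {P : A → Set} {f : A → B} {xs : List A}
  → (∀ {x y} → P x → P y → f x ≡ f y → x ≡ y) → All P xs → Unique xs → Unique (map f xs)
Unique-map⁺ inj [] [] = []
Unique-map⁺ inj (px ∷ pxs) (x∉xs ∷ u) =
  All.map⁺ (All.zipWith (λ (py , x≢y) → x≢y ∘ inj px py) (pxs , x∉xs)) ∷ Unique-map⁺ inj pxs u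

∑-reindex : {A B : Set} {P : A → Set} (xs : List A) (ys : List B) (φ : A → B) (w : B → ℕ)
  → Unique xs → Unique ys → All P xs
  → (∀ {x y} → P x → P y → φ x ≡ φ y → x ≡ y)
  → (∀ {x} → x ∈ xs → φ x ∈ ys)
  → (∀ {y} → y ∈ ys → ∃ λ x → x ∈ xs × y ≡ φ x)
  → ∑ xs (w ∘ φ) ≡ ∑ ys w
∑-reindex xs ys φ w uxs uys pxs inj into onto =
  trans (cong sum (map-∘ xs)) (sum-↭ (map⁺ w (∼bag⇒↭ (unique∧set⇒bag (Unique-map⁺ inj pxs uxs) uys (mk⇔ to from)))))
  where
  to : ∀ {y} → y ∈ map φ xs → y ∈ ys
  to y∈ with _ , x∈ , refl ← ∈-map⁻ φ y∈ = into x∈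
  from : ∀ {y} → y ∈ ys → y ∈ map φ xs
  from y∈ with _ , x∈ , refl ← onto y∈ = ∈-map⁺ φ x∈

∏ : {A : Set} → List A → (A → ℕ) → ℕ
∏ xs f = product (map f xs)

∏-* : {A : Set} (xs : List A) (f g : A → ℕ) → ∏ xs (λ x → f x * g x) ≡ ∏ xs f * ∏ xs g
∏-* [] f g = refl
∏-* (x ∷ xs) f g =
  trans (cong (f x * g x *_) (∏-* xs f g)) (interchange *-commutativeSemigroup (f x) (g x) _ _)

∏-1 : {A : Set} (xs : List A) → ∏ xs (λ _ → 1) ≡ 1
∏-1 [] = refl
∏-1 (x ∷ xs) = trans (+-identityʳ _) (∏-1 xs)

∏∏-comm : {A B : Set} (xs : List A) (ys : List B) (g : A → B → ℕ)
        → ∏ xs (λ x → ∏ ys (g x)) ≡ ∏ ys (λ y → ∏ xs (λ x → g x y))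
∏∏-comm [] ys g = sym (∏-1 ys)
∏∏-comm (x ∷ xs) ys g =
  trans (cong (∏ ys (g x) *_) (∏∏-comm xs ys g)) (sym (∏-* ys (g x) _))

∏-replicate-++ : {A : Set} (g : A → ℕ) (c : ℕ) (x : A) (l : List A) → ∏ (replicate c x ++ l) g ≡ g x ^ c * ∏ l g
∏-replicate-++ g zero x l = sym (+-identityʳ _)
∏-replicate-++ g (suc c) x l = trans (cong (g x *_) (∏-replicate-++ g c x l)) (sym (*-assoc (g x) _ _))

applyUpTo-cong-< : {A : Set} {f g : ℕ → A} (k : ℕ) → (∀ {i} → i < k → f i ≡ g i) → applyUpTo f k ≡ applyUpTo g k
applyUpTo-cong-< zero eq = refl
applyUpTo-cong-< (suc k) eq = cong₂ _∷_ (eq z<s) (applyUpTo-cong-< k (eq ∘ s<s))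

applyUpTo-+-suc : {A : Set} (h : ℕ → A) (v k : ℕ)
                → applyUpTo (λ i → h (v + i)) (suc k) ≡ h v ∷ applyUpTo (λ i → h (suc v + i)) k
applyUpTo-+-suc h v k = cong₂ _∷_ (cong h (+-identityʳ v)) (applyUpTo-cong-< k (λ {i} _ → cong h (+-suc v i)))

applyUpTo-∸ : {A : Set} (g : ℕ → A) (k : ℕ) → applyUpTo (λ i → g (k ∸ i)) k ≡ applyDownFrom (g ∘ suc) k
applyUpTo-∸ g zero = refl
applyUpTo-∸ g (suc k) = cong (g (suc k) ∷_) (applyUpTo-∸ g k)

toList-tabulate : {A : Set} (k : ℕ) (h : ℕ → A) → toList (Vec.tabulate {n = k} (h ∘ toℕ)) ≡ applyUpTo h k
toList-tabulate zero h = refl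
toList-tabulate (suc k) h = cong (h 0 ∷_) (toList-tabulate k (h ∘ suc))

zipWith-tabulate : {A B C : Set} (_∙_ : A → B → C) {k : ℕ} (f : Fin k → A) (g : Fin k → B)
                 → Vec.zipWith _∙_ (Vec.tabulate f) (Vec.tabulate g) ≡ Vec.tabulate (λ i → f i ∙ g i)
zipWith-tabulate _∙_ {zero} f g = refl
zipWith-tabulate _∙_ {suc k} f g = cong (_ ∷_) (zipWith-tabulate _∙_ (f ∘ Fin.suc) (g ∘ Fin.suc))

-- Counting the tuples above a fixed s₀

∈-boundedVecs⁺ : ∀ {n B} (v : Vec ℕ n) → All (_≤ B) (toList v) → v ∈ boundedVecs n B
∈-boundedVecs⁺ [] [] = here refl
∈-boundedVecs⁺ (x ∷ v) (x≤B ∷ v≤B) =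
  ∈-cartesianProductWith⁺ _∷_ (∈-upTo⁺ (s≤s x≤B)) (∈-boundedVecs⁺ v v≤B)

∈-boundedVecs⁻ : ∀ n {B} {v : Vec ℕ n} → v ∈ boundedVecs n B → All (_≤ B) (toList v)
∈-boundedVecs⁻ zero {v = []} _ = []
∈-boundedVecs⁻ (suc n) {B} v∈
  with _ , _ , y∈ , w∈ , refl ← ∈-cartesianProductWith⁻ _∷_ (upTo (suc B)) (boundedVecs n B) v∈ =
  ≤-pred (∈-upTo⁻ y∈) ∷ ∈-boundedVecs⁻ n w∈

boundedVecs-unique : ∀ n B → Unique (boundedVecs n B)
boundedVecs-unique zero B = [] ∷ []
boundedVecs-unique (suc n) B =
  Unique.cartesianProductWith⁺ _∷_ (λ { refl → refl , refl }) (Unique.upTo⁺ (suc B)) (boundedVecs-unique n B)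

sortedSequences : (μ : List ℕ) (k : ℕ) → List (Vec ℕ (sum μ))
sortedSequences μ k = filter (InS? μ k) (boundedVecs (sum μ) k)

∈-sortedSequences⁻ : ∀ μ k {s} → s ∈ sortedSequences μ k → InS μ k s
∈-sortedSequences⁻ μ k = proj₂ ∘ ∈-filter⁻ (InS? μ k) {xs = boundedVecs (sum μ) k}

rearrangements : (μ : List ℕ) (k : ℕ) → List (Vec ℕ k)
rearrangements μ k = filter (λ e → sameMultiset? (toList e) (padded μ k)) (boundedVecs k (sum μ))

count-≤-upTo : ∀ x m → ∑ (upTo m) (λ y → 𝟙 (x ≤? y)) ≡ m ∸ x
count-≤-upTo x zero = sym (0∸n≡0 x)
count-≤-upTo x (suc m) = begin
  ∑ (upTo (suc m)) 𝟙[x≤]           ≡⟨ cong (λ ys → ∑ ys 𝟙[x≤]) (upTo-∷ʳ m) ⟨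
  ∑ (upTo m ∷ʳ m) 𝟙[x≤]            ≡⟨ ∑-++ (upTo m) (m ∷ []) 𝟙[x≤] ⟩
  ∑ (upTo m) 𝟙[x≤] + (𝟙[x≤] m + 0) ≡⟨ cong₂ _+_ (count-≤-upTo x m) (+-identityʳ _) ⟩
  m ∸ x + 𝟙[x≤] m                  ≡⟨ suc-m∸x (x ≤? m) ⟩
  suc m ∸ x                        ∎
  where
  open ≡-Reasoning
  𝟙[x≤] : ℕ → ℕ
  𝟙[x≤] y = 𝟙 (x ≤? y)
  suc-m∸x : (x≤?m : Dec (x ≤ m)) → m ∸ x + 𝟙 x≤?m ≡ suc m ∸ x
  suc-m∸x (yes x≤m) = trans (+-comm (m ∸ x) 1) (sym (+-∸-assoc 1 x≤m))
  suc-m∸x (no x≰m)  = trans (+-identityʳ _) (trans (m≤n⇒m∸n≡0 (<⇒≤ x>m)) (sym (m≤n⇒m∸n≡0 x>m)))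
    where x>m = ≰⇒> x≰m

Between : ∀ {n} → Vec ℕ n → ℕ → Vec ℕ n → Set
Between s B v = Pointwise _≤_ s v × VAll (_≤ B) v

between? : ∀ {n} (s : Vec ℕ n) (B : ℕ) (v : Vec ℕ n) → Dec (Between s B v)
between? s B v = Pointwise.decidable _≤?_ s v ×-dec VAll.all? (_≤? B) v

𝟙-between?-∷ : ∀ {n y B} x (s w : Vec ℕ n) → y ≤ B
             → 𝟙 (between? (x ∷ s) B (y ∷ w)) ≡ 𝟙 (x ≤? y) * 𝟙 (between? s B w)
𝟙-between?-∷ {y = y} {B} x s w y≤B rewrite dec-true (y ≤? B) y≤B with does (x ≤? y)
... | true  = sym (+-identityʳ _)
... | false = refl

count-between : ∀ {n} (s : Vec ℕ n) (B : ℕ)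
              → ∑ (boundedVecs n B) (𝟙 ∘ between? s B) ≡ ∏ (toList s) (λ x → suc B ∸ x)
count-between [] B = refl
count-between {suc n} (x ∷ s) B = begin
  ∑ (boundedVecs (suc n) B) (𝟙 ∘ between? (x ∷ s) B)
    ≡⟨ ∑-cartesianProductWith _∷_ (upTo (suc B)) (boundedVecs n B) _ ⟩
  ∑ (upTo (suc B)) (λ y → ∑ (boundedVecs n B) (λ w → 𝟙 (between? (x ∷ s) B (y ∷ w))))
    ≡⟨ ∑-cong (upTo (suc B)) (λ {y} y∈ → ∑-cong (boundedVecs n B) (λ {w} _ →
         𝟙-between?-∷ x s w (≤-pred (∈-upTo⁻ y∈)))) ⟩
  ∑ (upTo (suc B)) (λ y → ∑ (boundedVecs n B) (λ w → 𝟙 (x ≤? y) * 𝟙 (between? s B w)))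
    ≡⟨ ∑∑-* (upTo (suc B)) (boundedVecs n B) (λ y → 𝟙 (x ≤? y)) (𝟙 ∘ between? s B) ⟩
  ∑ (upTo (suc B)) (λ y → 𝟙 (x ≤? y)) * ∑ (boundedVecs n B) (𝟙 ∘ between? s B)
    ≡⟨ cong₂ _*_ (count-≤-upTo x (suc B)) (count-between s B) ⟩
  (suc B ∸ x) * ∏ (toList s) (λ x → suc B ∸ x) ∎
  where open ≡-Reasoning

validSeqs? : ∀ {n r} (s₀ : Vec ℕ n) (k : ℕ) (a : Vec ℕ r) (ss : Vec (Vec ℕ n) r)
           → Dec (VAll (λ p → Between s₀ (k + proj₁ p) (proj₂ p)) (zip a ss))
validSeqs? s₀ k a ss = VAll.all? (λ p → between? s₀ (k + proj₁ p) (proj₂ p)) (zip a ss)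

count-validSeqs : ∀ {n r} (s₀ : Vec ℕ n) (k : ℕ) (a : Vec ℕ r)
  → ∑ (candidateSeqs n k a) (𝟙 ∘ validSeqs? s₀ k a)
    ≡ ∏ (toList a) (λ aᵢ → ∏ (toList s₀) (λ x → suc (k + aᵢ) ∸ x))
count-validSeqs {n} s₀ k [] = refl
count-validSeqs {n} s₀ k (aᵢ ∷ a) = begin
  ∑ (candidateSeqs n k (aᵢ ∷ a)) (𝟙 ∘ validSeqs? s₀ k (aᵢ ∷ a))
    ≡⟨ ∑-cartesianProductWith _∷_ (boundedVecs n (k + aᵢ)) (candidateSeqs n k a) _ ⟩
  ∑ (boundedVecs n (k + aᵢ)) (λ v → ∑ (candidateSeqs n k a) (λ ss → 𝟙 (validSeqs? s₀ k (aᵢ ∷ a) (v ∷ ss))))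
    ≡⟨ ∑-cong (boundedVecs n (k + aᵢ)) (λ {v} _ → ∑-cong (candidateSeqs n k a) (λ {ss} _ →
         𝟙-×-dec (between? s₀ (k + aᵢ) v) (validSeqs? s₀ k a ss))) ⟩
  ∑ (boundedVecs n (k + aᵢ)) (λ v → ∑ (candidateSeqs n k a) (λ ss →
    𝟙 (between? s₀ (k + aᵢ) v) * 𝟙 (validSeqs? s₀ k a ss)))
    ≡⟨ ∑∑-* (boundedVecs n (k + aᵢ)) (candidateSeqs n k a) _ _ ⟩
  ∑ (boundedVecs n (k + aᵢ)) (𝟙 ∘ between? s₀ (k + aᵢ)) * ∑ (candidateSeqs n k a) (𝟙 ∘ validSeqs? s₀ k a)
    ≡⟨ cong₂ _*_ (count-between s₀ (k + aᵢ)) (count-validSeqs s₀ k a) ⟩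
  ∏ (toList (aᵢ ∷ a)) (λ aᵢ → ∏ (toList s₀) (λ x → suc (k + aᵢ) ∸ x)) ∎
  where open ≡-Reasoning

weight : ∀ {r n} → Vec ℕ r → ℕ → Vec ℕ n → ℕ
weight a k s = ∏ (toList s) (λ x → fpoly a (suc k ∸ x))

count-validSeqs≡weight : ∀ {n r} (s₀ : Vec ℕ n) (k : ℕ) (a : Vec ℕ r) → All (_≤ k) (toList s₀)
  → ∑ (candidateSeqs n k a) (𝟙 ∘ validSeqs? s₀ k a) ≡ weight a k s₀
count-validSeqs≡weight s₀ k a s₀≤k = begin
  ∑ (candidateSeqs _ k a) (𝟙 ∘ validSeqs? s₀ k a)
    ≡⟨ count-validSeqs s₀ k a ⟩
  ∏ (toList a) (λ aᵢ → ∏ (toList s₀) (λ x → suc k + aᵢ ∸ x))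
    ≡⟨ ∏∏-comm (toList a) (toList s₀) _ ⟩
  ∏ (toList s₀) (λ x → ∏ (toList a) (λ aᵢ → suc k + aᵢ ∸ x))
    ≡⟨ cong product (map-cong-local (All.map (λ x≤k →
         cong product (map-cong (λ aᵢ → +-∸-comm aᵢ (m≤n⇒m≤1+n x≤k)) (toList a))) s₀≤k)) ⟩
  ∏ (toList s₀) (λ x → ∏ (toList a) (suc k ∸ x +_))
    ≡⟨ cong product (map-cong (λ x → cong product (toList-map (suc k ∸ x +_) a)) (toList s₀)) ⟨
  weight a k s₀ ∎
  where open ≡-Reasoning

countTuples≡∑weight : (μ : List ℕ) (k : ℕ) {r : ℕ} (a : Vec ℕ r)
  → countTuples μ k a ≡ ∑ (sortedSequences μ k) (weight a k)
countTuples≡∑weight μ k a = begin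
  countTuples μ k a
    ≡⟨ length-filter≡∑𝟙 (ValidTuple? μ k a) (cartesianProduct S₀ Ss) ⟩
  ∑ (cartesianProduct S₀ Ss) (𝟙 ∘ ValidTuple? μ k a)
    ≡⟨ ∑-cartesianProductWith _,_ S₀ Ss _ ⟩
  ∑ S₀ (λ s₀ → ∑ Ss (λ ss → 𝟙 (InS? μ k s₀ ×-dec validSeqs? s₀ k a ss)))
    ≡⟨ ∑-cong S₀ (λ {s₀} _ → ∑-cong Ss (λ {ss} _ → 𝟙-×-dec (InS? μ k s₀) (validSeqs? s₀ k a ss))) ⟩
  ∑ S₀ (λ s₀ → ∑ Ss (λ ss → 𝟙 (InS? μ k s₀) * 𝟙 (validSeqs? s₀ k a ss)))
    ≡⟨ ∑-cong S₀ (λ {s₀} s₀∈ → trans (∑-*ˡ (𝟙 (InS? μ k s₀)) Ss (𝟙 ∘ validSeqs? s₀ k a))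
         (cong (𝟙 (InS? μ k s₀) *_)
         (count-validSeqs≡weight s₀ k a (∈-boundedVecs⁻ (sum μ) s₀∈)))) ⟩
  ∑ S₀ (λ s₀ → 𝟙 (InS? μ k s₀) * weight a k s₀)
    ≡⟨ ∑-filter (InS? μ k) S₀ (weight a k) ⟨
  ∑ (sortedSequences μ k) (weight a k) ∎
  where
  open ≡-Reasoning
  S₀ = boundedVecs (sum μ) k
  Ss = candidateSeqs (sum μ) k a

mult-here : ∀ v l → mult v (v ∷ l) ≡ suc (mult v l)
mult-here v l = cong length (filter-accept (v ≟_) refl)

mult-there : ∀ {v x} l → v ≢ x → mult v (x ∷ l) ≡ mult v l
mult-there l v≢x = cong length (filter-reject (_ ≟_) v≢x)

mult-∉ : ∀ {v} l → v ∉ l → mult v l ≡ 0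
mult-∉ [] v∉l = refl
mult-∉ (x ∷ l) v∉l = trans (mult-there l (v∉l ∘ here)) (mult-∉ l (v∉l ∘ there))

mult-↭ : ∀ v {xs ys} → xs ↭ ys → mult v xs ≡ mult v ys
mult-↭ v xs↭ys = ↭-length (filter-↭ (v ≟_) xs↭ys)

mult≤length : ∀ v l → mult v l ≤ length l
mult≤length v = length-filter (v ≟_)

mult-∷-cancel : ∀ x {v} xs ys → mult v (x ∷ xs) ≡ mult v (x ∷ ys) → mult v xs ≡ mult v ys
mult-∷-cancel x {v} xs ys eq with v ≟ x
... | yes refl = suc-injective (trans (sym (mult-here v xs)) (trans eq (mult-here v ys)))
... | no v≢x  = trans (sym (mult-there xs v≢x)) (trans eq (mult-there ys v≢x))

mult≡⇒↭ : ∀ xs ys → (∀ v → mult v xs ≡ mult v ys) → xs ↭ ys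
mult≡⇒↭ [] [] eq = ↭-refl
mult≡⇒↭ [] (y ∷ ys) eq with () ← trans (eq y) (mult-here y ys)
mult≡⇒↭ (x ∷ xs) ys eq with x ∈? ys
... | no x∉ys with () ← trans (sym (mult-here x xs)) (trans (eq x) (mult-∉ ys x∉ys))
... | yes x∈ys with p , q , refl ← ∈-∃++ x∈ys =
  ↭-trans (↭-prep x (mult≡⇒↭ xs (p ++ q) eq′)) (↭-sym (shift x p q))
  where
  eq′ : ∀ v → mult v xs ≡ mult v (p ++ q)
  eq′ v = mult-∷-cancel x xs (p ++ q) (trans (eq v) (mult-↭ v (shift x p q)))

SameMultiset⇒↭ : ∀ xs ys → SameMultiset xs ys → xs ↭ ys
SameMultiset⇒↭ xs ys same = mult≡⇒↭ xs ys mult≡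
  where
  mult≡ : ∀ v → mult v xs ≡ mult v ys
  mult≡ v with v ∈? (xs ++ ys)
  ... | yes v∈ = All.lookup same v∈
  ... | no v∉ = trans (mult-∉ xs (v∉ ∘ ∈-++⁺ˡ)) (sym (mult-∉ ys (v∉ ∘ ∈-++⁺ʳ xs)))

↭⇒SameMultiset : ∀ {xs ys} → xs ↭ ys → SameMultiset xs ys
↭⇒SameMultiset xs↭ys = All.tabulate (λ {v} _ → mult-↭ v xs↭ys)

mult-replicate-++ : ∀ v c l → mult v (replicate c v ++ l) ≡ c + mult v l
mult-replicate-++ v zero l = refl
mult-replicate-++ v (suc c) l = trans (mult-here v _) (cong suc (mult-replicate-++ v c l))

mult-All< : ∀ {v} l → All (v <_) l → mult v l ≡ 0
mult-All< l v<l = mult-∉ l (All.All¬⇒¬Any (All.map <⇒≢ v<l))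

sum-padded : ∀ μ k → sum (padded μ k) ≡ sum μ
sum-padded μ k = trans (sum-++ μ _) (trans (cong (sum μ +_) (sum-replicate-0 (k ∸ length μ))) (+-identityʳ _))
  where
  sum-replicate-0 : ∀ m → sum (replicate m 0) ≡ 0
  sum-replicate-0 zero = refl
  sum-replicate-0 (suc m) = sum-replicate-0 m

SameMultiset-padded⇒sum≡ : ∀ μ k xs → SameMultiset xs (padded μ k) → sum xs ≡ sum μ
SameMultiset-padded⇒sum≡ μ k xs same = trans (sum-↭ (SameMultiset⇒↭ xs (padded μ k) same)) (sum-padded μ k)

-- Weakly increasing sequences and their multiplicity vectors

multiplicities : ℕ → ℕ → List ℕ → List ℕ
multiplicities v zero    l = []
multiplicities v (suc k) l = mult v l ∷ multiplicities (suc v) k l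

expand : ℕ → List ℕ → List ℕ
expand v []       = []
expand v (c ∷ cs) = replicate c v ++ expand (suc v) cs

multiplicities-∷-below : ∀ k {v x} l → x < v → multiplicities v k (x ∷ l) ≡ multiplicities v k l
multiplicities-∷-below zero l x<v = refl
multiplicities-∷-below (suc k) l x<v =
  cong₂ _∷_ (mult-there l (≢-sym (<⇒≢ x<v))) (multiplicities-∷-below k l (m<n⇒m<1+n x<v))

multiplicities-replicate-below : ∀ k c {v x} l → x < v → multiplicities v k (replicate c x ++ l) ≡ multiplicities v k l
multiplicities-replicate-below k zero l x<v = refl
multiplicities-replicate-below k (suc c) l x<v =
  trans (multiplicities-∷-below k _ x<v) (multiplicities-replicate-below k c l x<v)

expand-bounded : ∀ v c → All (λ x → v ≤ x × x < v + length c) (expand v c)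
expand-bounded v [] = []
expand-bounded v (c ∷ cs) =
  All.++⁺ (All.replicate⁺ c (≤-refl , m<m+n v z<s))
          (All.map (λ {x} (v<x , x<) → <⇒≤ v<x , subst (x <_) (sym (+-suc v _)) x<) (expand-bounded (suc v) cs))

∷-sorted : ∀ {x xs} → All (x ≤_) xs → Linked _≤_ xs → Linked _≤_ (x ∷ xs)
∷-sorted [] [] = [-]
∷-sorted (x≤y ∷ _) sorted = x≤y ∷ sorted

expand-sorted : ∀ v c → Linked _≤_ (expand v c)
expand-sorted v [] = []
expand-sorted v (c ∷ cs) = replicate-sorted c
  where
  rest-above : All (v ≤_) (expand (suc v) cs)
  rest-above = All.map (<⇒≤ ∘ proj₁) (expand-bounded (suc v) cs)
  replicate-sorted : ∀ c → Linked _≤_ (replicate c v ++ expand (suc v) cs)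
  replicate-sorted zero = expand-sorted (suc v) cs
  replicate-sorted (suc c) =
    ∷-sorted (All.++⁺ (All.replicate⁺ c ≤-refl) rest-above) (replicate-sorted c)

length-expand : ∀ v c → length (expand v c) ≡ sum c
length-expand v [] = refl
length-expand v (c ∷ cs) =
  trans (length-++ (replicate c v)) (cong₂ _+_ (length-replicate c) (length-expand (suc v) cs))

multiplicities-expand : ∀ v c → multiplicities v (length c) (expand v c) ≡ c
multiplicities-expand v [] = refl
multiplicities-expand v (c ∷ cs) = cong₂ _∷_
  (trans (mult-replicate-++ v c rest)
    (trans (cong (c +_) (mult-All< rest (All.map proj₁ (expand-bounded (suc v) cs)))) (+-identityʳ c)))
  (trans (multiplicities-replicate-below (length cs) c rest (n<1+n v)) (multiplicities-expand (suc v) cs))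
  where rest = expand (suc v) cs

expand-multiplicities-[] : ∀ k v → expand v (multiplicities v k []) ≡ []
expand-multiplicities-[] zero v = refl
expand-multiplicities-[] (suc k) v = expand-multiplicities-[] k (suc v)

expand-multiplicities : ∀ k v l → Linked _≤_ l → All (λ x → v ≤ x × x < v + k) l
                      → expand v (multiplicities v k l) ≡ l
expand-multiplicities k v [] _ _ = expand-multiplicities-[] k v
-- k is split only after the with, so that the recursion visibly descends lexicographically in (k, l).
expand-multiplicities k v (x ∷ l) sorted bounds with v ≟ x
expand-multiplicities zero v (x ∷ l) _ ((v≤x , x<v+0) ∷ _) | _ =
  ⊥-elim (<⇒≱ (subst (x <_) (+-identityʳ v) x<v+0) v≤x)
expand-multiplicities (suc k) v (v ∷ l) sorted bounds | yes refl = trans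
  (cong₂ (λ m c → replicate m v ++ expand (suc v) c) (mult-here v l) (multiplicities-∷-below k l (n<1+n v)))
  (cong (v ∷_) (expand-multiplicities (suc k) v l (Linked.tail sorted) (All.tail bounds)))
expand-multiplicities (suc k) v (x ∷ l) sorted bounds | no v≢x = trans
  (cong (λ m → replicate m v ++ expand (suc v) (multiplicities (suc v) k (x ∷ l))) (mult-All< (x ∷ l) above))
  (expand-multiplicities k (suc v) (x ∷ l) sorted
    (All.zipWith (λ {y} (v<y , _ , y<) → v<y , subst (y <_) (+-suc v k) y<) (above , bounds)))
  where
  above : All (v <_) (x ∷ l)
  above = Linked⇒All ≤-trans (≤∧≢⇒< (proj₁ (All.head bounds)) v≢x) sorted

multiplicities≡applyUpTo : ∀ v k l → multiplicities v k l ≡ applyUpTo (λ i → mult (v + i) l) k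
multiplicities≡applyUpTo v zero l = refl
multiplicities≡applyUpTo v (suc k) l =
  trans (cong (mult v l ∷_) (multiplicities≡applyUpTo (suc v) k l)) (sym (applyUpTo-+-suc (λ u → mult u l) v k))

∏-expand-multiplicities : ∀ (g : ℕ → ℕ) k v l
  → ∏ (expand v (multiplicities v k l)) g ≡ product (applyUpTo (λ i → g (v + i) ^ mult (v + i) l) k)
∏-expand-multiplicities g zero v l = refl
∏-expand-multiplicities g (suc k) v l = begin
  ∏ (replicate (mult v l) v ++ expand (suc v) (multiplicities (suc v) k l)) g
    ≡⟨ ∏-replicate-++ g (mult v l) v _ ⟩
  g v ^ mult v l * ∏ (expand (suc v) (multiplicities (suc v) k l)) g
    ≡⟨ cong (g v ^ mult v l *_) (∏-expand-multiplicities g k (suc v) l) ⟩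
  g v ^ mult v l * product (applyUpTo (λ i → g (suc v + i) ^ mult (suc v + i) l) k)
    ≡⟨ cong product (applyUpTo-+-suc (λ u → g u ^ mult u l) v k) ⟨
  product (applyUpTo (λ i → g (v + i) ^ mult (v + i) l) (suc k)) ∎
  where open ≡-Reasoning

SortedIn : ℕ → List ℕ → Set
SortedIn k l = All (λ x → 1 ≤ x × x ≤ k) l × Linked _≤_ l

InS⇒SortedIn : ∀ {μ k s} → InS μ k s → SortedIn k (toList s)
InS⇒SortedIn (bounds , sorted , _) = bounds , sorted

expand-multiplicities₁ : ∀ {k l} → SortedIn k l → expand 1 (multiplicities 1 k l) ≡ l
expand-multiplicities₁ {k} {l} (bounds , sorted) =
  expand-multiplicities k 1 l sorted (All.map (λ (1≤x , x≤k) → 1≤x , s≤s x≤k) bounds)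

multiplicities-onto : ∀ {n k} (c : List ℕ) → length c ≡ k → sum c ≡ n
  → ∃ λ (s : Vec ℕ n) → SortedIn k (toList s) × multiplicities 1 k (toList s) ≡ c
multiplicities-onto c refl sum≡n =
  s , subst (SortedIn (length c)) (sym toList-s) (bounds , expand-sorted 1 c) ,
  trans (cong (multiplicities 1 (length c)) toList-s) (multiplicities-expand 1 c)
  where
  length≡n = trans (length-expand 1 c) sum≡n
  s = Vec.cast length≡n (Vec.fromList (expand 1 c))
  toList-s : toList s ≡ expand 1 c
  toList-s = trans (toList-cast length≡n (Vec.fromList (expand 1 c))) (toList∘fromList (expand 1 c))
  bounds : All (λ x → 1 ≤ x × x ≤ length c) (expand 1 c)
  bounds = All.map (λ (1≤x , x<1+k) → 1≤x , ≤-pred x<1+k) (expand-bounded 1 c)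

-- The bijection onto exponent vectors

-- Entry j (counting from 0) is the multiplicity of the value k − j, which is the exponent of
-- f(j + 1) = f(k + 1 − (k − j)) in the contribution of the sequence.
exponents : (k : ℕ) {n : ℕ} → Vec ℕ n → Vec ℕ k
exponents k s = Vec.tabulate (λ i → mult (k ∸ toℕ i) (toList s))

toList-exponents : ∀ k {n} (s : Vec ℕ n) → toList (exponents k s) ≡ reverse (multiplicities 1 k (toList s))
toList-exponents k s = begin
  toList (exponents k s)                                  ≡⟨ toList-tabulate k (λ i → mult (k ∸ i) (toList s)) ⟩
  applyUpTo (λ i → mult (k ∸ i) (toList s)) k             ≡⟨ applyUpTo-∸ (λ u → mult u (toList s)) k ⟩
  applyDownFrom (λ i → mult (suc i) (toList s)) k         ≡⟨ reverse-applyUpTo (λ i → mult (suc i) (toList s)) k ⟨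
  reverse (applyUpTo (λ i → mult (suc i) (toList s)) k)   ≡⟨ cong reverse (multiplicities≡applyUpTo 1 k (toList s)) ⟨
  reverse (multiplicities 1 k (toList s))                 ∎
  where open ≡-Reasoning

exponents-↭ : ∀ k {n} (s : Vec ℕ n) → toList (exponents k s) ↭ applyUpTo (λ i → mult (suc i) (toList s)) k
exponents-↭ k s = begin
  toList (exponents k s)                           ≡⟨ toList-exponents k s ⟩
  reverse (multiplicities 1 k (toList s))          ↭⟨ ↭-reverse _ ⟩
  multiplicities 1 k (toList s)                    ≡⟨ multiplicities≡applyUpTo 1 k (toList s) ⟩
  applyUpTo (λ i → mult (suc i) (toList s)) k      ∎
  where open PermutationReasoning

monomialTerm : {k : ℕ} → Vec ℕ k → Vec ℕ k → ℕ
monomialTerm x e = product (toList (Vec.zipWith _^_ x e))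

weight≡monomialTerm : ∀ {r n} (a : Vec ℕ r) k (s : Vec ℕ n) → SortedIn k (toList s)
                    → weight a k s ≡ monomialTerm (fvals a k) (exponents k s)
weight≡monomialTerm a k s sortedIn = begin
  ∏ l G                                                   ≡⟨ cong (λ l′ → ∏ l′ G) (expand-multiplicities₁ sortedIn) ⟨
  ∏ (expand 1 (multiplicities 1 k l)) G                   ≡⟨ ∏-expand-multiplicities G k 1 l ⟩
  product (applyUpTo (H ∘ suc) k)                         ≡⟨ product-↭ (↭-reverse (applyUpTo (H ∘ suc) k)) ⟨
  product (reverse (applyUpTo (H ∘ suc) k))               ≡⟨ cong product (reverse-applyUpTo (H ∘ suc) k) ⟩
  product (applyDownFrom (H ∘ suc) k)                     ≡⟨ cong product (applyUpTo-∸ H k) ⟨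
  product (applyUpTo (λ i → H (k ∸ i)) k)
    ≡⟨ cong product (applyUpTo-cong-< k (λ {i} i<k → cong (λ u → fpoly a u ^ mult (k ∸ i) l) (suc-∸-∸ i<k))) ⟩
  product (applyUpTo (λ i → fpoly a (suc i) ^ mult (k ∸ i) l) k)
    ≡⟨ cong product (toList-tabulate k (λ i → fpoly a (suc i) ^ mult (k ∸ i) l)) ⟨
  product (toList (Vec.tabulate {n = k} (λ i → fpoly a (suc (toℕ i)) ^ mult (k ∸ toℕ i) l)))
    ≡⟨ cong (product ∘ toList) (zipWith-tabulate _^_ {k} (λ i → fpoly a (suc (toℕ i))) (λ i → mult (k ∸ toℕ i) l)) ⟨
  monomialTerm (fvals a k) (exponents k s) ∎
  where
  open ≡-Reasoning
  l = toList s
  G : ℕ → ℕ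
  G x = fpoly a (suc k ∸ x)
  H : ℕ → ℕ
  H u = G u ^ mult u l
  suc-∸-∸ : ∀ {i} → i < k → suc k ∸ (k ∸ i) ≡ suc i
  suc-∸-∸ {i} i<k = trans (+-∸-assoc 1 (m∸n≤m k i)) (cong suc (m∸[m∸n]≡n (<⇒≤ i<k)))

exponents-∈ : ∀ μ k {s} → s ∈ sortedSequences μ k → exponents k s ∈ rearrangements μ k
exponents-∈ μ k {s} s∈ with _ , _ , same ← ∈-sortedSequences⁻ μ k s∈ =
  ∈-filter⁺ _ (∈-boundedVecs⁺ (exponents k s) exponents≤n)
    (↭⇒SameMultiset (↭-trans (exponents-↭ k s) (SameMultiset⇒↭ _ (padded μ k) same)))
  where
  exponents≤n : All (_≤ sum μ) (toList (exponents k s))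
  exponents≤n = subst (All (_≤ sum μ)) (sym (toList-tabulate k (λ i → mult (k ∸ i) (toList s))))
    (All.applyUpTo⁺₂ _ k (λ i → subst (mult (k ∸ i) (toList s) ≤_) (length-toList s) (mult≤length (k ∸ i) (toList s))))

exponents-injective : ∀ k {n} {s s′ : Vec ℕ n} → SortedIn k (toList s) → SortedIn k (toList s′)
                    → exponents k s ≡ exponents k s′ → s ≡ s′
exponents-injective k {s = s} {s′} sortedIn sortedIn′ eq =
  trans (sym (cast-is-id refl s)) (toList-injective refl s s′ (begin
    toList s                                   ≡⟨ expand-multiplicities₁ sortedIn ⟨
    expand 1 (multiplicities 1 k (toList s))   ≡⟨ cong (expand 1) same-multiplicities ⟩
    expand 1 (multiplicities 1 k (toList s′))  ≡⟨ expand-multiplicities₁ sortedIn′ ⟩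
    toList s′                                  ∎))
  where
  open ≡-Reasoning
  same-multiplicities : multiplicities 1 k (toList s) ≡ multiplicities 1 k (toList s′)
  same-multiplicities = reverse-injective (begin
    reverse (multiplicities 1 k (toList s))   ≡⟨ toList-exponents k s ⟨
    toList (exponents k s)                    ≡⟨ cong toList eq ⟩
    toList (exponents k s′)                   ≡⟨ toList-exponents k s′ ⟩
    reverse (multiplicities 1 k (toList s′))  ∎)

exponents-onto : ∀ μ k {e} → e ∈ rearrangements μ k → ∃ λ s → s ∈ sortedSequences μ k × e ≡ exponents k s
exponents-onto μ k {e} e∈ with _ , same ← ∈-filter⁻ _ {xs = boundedVecs k (sum μ)} e∈
  with s , (bounds , sorted) , multiplicities≡c ← multiplicities-onto (reverse (toList e))
         (trans (length-reverse (toList e)) (length-toList e))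
         (trans (sum-↭ (↭-reverse (toList e))) (SameMultiset-padded⇒sum≡ μ k (toList e) same)) =
  s , ∈-filter⁺ (InS? μ k) (∈-boundedVecs⁺ s (All.map proj₂ bounds)) (bounds , sorted , same′) , e≡exponents
  where
  e≡exponents : e ≡ exponents k s
  e≡exponents = trans (sym (cast-is-id refl e)) (toList-injective refl e (exponents k s) (begin
    toList e                                 ≡⟨ reverse-involutive (toList e) ⟨
    reverse (reverse (toList e))             ≡⟨ cong reverse multiplicities≡c ⟨
    reverse (multiplicities 1 k (toList s))  ≡⟨ toList-exponents k s ⟨
    toList (exponents k s)                   ∎))
    where open ≡-Reasoning
  same′ : SameMultiset (applyUpTo (λ i → mult (suc i) (toList s)) k) (padded μ k)
  same′ = ↭⇒SameMultiset (begin
    applyUpTo (λ i → mult (suc i) (toList s)) k  ↭⟨ exponents-↭ k s ⟨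
    toList (exponents k s)                       ≡⟨ cong toList e≡exponents ⟨
    toList e                                     ↭⟨ SameMultiset⇒↭ (toList e) (padded μ k) same ⟩
    padded μ k                                   ∎)
    where open PermutationReasoning

propositionP : (r : ℕ) → 1 ≤ r → (a : Vec ℕ r)
             → (μ : List ℕ) → IsPartition μ
             → (k : ℕ) → length μ ≤ k
             → monomial μ k (fvals a k) ≡ countTuples μ k a
propositionP r _ a μ _ k _ = begin
  monomial μ k (fvals a k)
    ≡⟨ ∑-reindex (sortedSequences μ k) (rearrangements μ k) (exponents k) (monomialTerm (fvals a k))
         (Unique.filter⁺ (InS? μ k) (boundedVecs-unique (sum μ) k))
         (Unique.filter⁺ _ (boundedVecs-unique k (sum μ)))
         (All.all-filter (InS? μ k) (boundedVecs (sum μ) k))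
         (λ s∈S s′∈S → exponents-injective k (InS⇒SortedIn {μ} s∈S) (InS⇒SortedIn {μ} s′∈S))
         (exponents-∈ μ k) (exponents-onto μ k) ⟨
  ∑ (sortedSequences μ k) (monomialTerm (fvals a k) ∘ exponents k)
    ≡⟨ ∑-cong (sortedSequences μ k) (λ {s} s∈ →
         weight≡monomialTerm a k s (InS⇒SortedIn {μ} (∈-sortedSequences⁻ μ k s∈))) ⟨
  ∑ (sortedSequences μ k) (weight a k)
    ≡⟨ countTuples≡∑weight μ k a ⟨
  countTuples μ k a ∎
  where open ≡-Reasoning
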